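{- Let $X=\{X_1,X_2\}$ be a $\lambda_2$-equitable $2$-partition of $J(n,3)$ with quotient matrix $(p_{ij})$ satisfying $p_{11}\geq p_{22}$ and $p_{11}\geq 2n-7$, and assume no vertex is of type (I) or (II). Let $\{a,b,c\}$ be a vertex with $\overline{abc}=1$, $\overline{ab\ast}-\overline{ac\ast}=(n-4)/2$ and $\overline{ac\ast}=\overline{bc\ast}$, such that for every $d\in[n]\setminus\{a,b,c\}$ the triple $(\overline{abd},\overline{acd},\overline{bcd})$ is $(1,1,1)$ or $(1,0,0)$. Then $n\leq 6$.
   Context: $J(n,3)$ ($n\geq 6$): vertices are the $3$-subsets of $[n]$, adjacent iff they share exactly two elements; it is $3(n-3)$-regular. An equitable $2$-partition with quotient matrix $(p_{ij})$ means each vertex of $X_i$ has exactly $p_{ij}$ neighbours in $X_j$; $\lambda_2$-equitable means $p_{11}-p_{21}=n-7$. $\overline{u}=1$ if $u\in X_1$, else $0$; $\overline{xyz}=\overline{\{x,y,z\}}$; $\overline{ij\ast}$ is the number of $3$-subsets containing $i,j$ lying in $X_1$. A vertex $v=\{x,y,z\}\in X_1$, labelled so that $\overline{xy\ast}\geq\overline{xz\ast}\geq\overline{yz\ast}$, is of type (I) if $(\overline{xy\ast}-\overline{xz\ast},\overline{xz\ast}-\overline{yz\ast})=(n-4,0)$ and of type (II) if this pair equals $((n-4)/2,(n-4)/2)$. -}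

module Defs where

open import Data.Nat using (ℕ; zero; suc; _+_; _*_; _∸_; _≤_; _≡ᵇ_)
open import Data.Bool using (Bool; true; false; _∧_; not)
open import Data.Fin using (Fin)
open import Data.Fin.Subset using (Subset; inside; outside; _∩_; _∪_; ⁅_⁆; ∣_∣)
open import Data.Vec using (Vec; []; _∷_; lookup)
open import Data.List using (List; []; _∷_; map; _++_)
open import Data.Product using (_×_; Σ; ∃-syntax; _,_)
open import Data.Sum using (_⊎_)
open import Relation.Binary.PropositionalEquality using (_≡_; _≢_)

allSubsets : (n : ℕ) → List (Subset n)
allSubsets zero = [] ∷ []
allSubsets (suc n) = map (inside ∷_) (allSubsets n) ++ map (outside ∷_) (allSubsets n)

countB : {A : Set} → (A → Bool) → List A → ℕ
countB p [] = 0
countB p (x ∷ xs) with p x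
... | true  = suc (countB p xs)
... | false = countB p xs

_∈ᵇ_ : {n : ℕ} → Fin n → Subset n → Bool
i ∈ᵇ s = lookup s i

isVertexᵇ : {n : ℕ} → Subset n → Bool
isVertexᵇ s = ∣ s ∣ ≡ᵇ 3

adjᵇ : {n : ℕ} → Subset n → Subset n → Bool
adjᵇ u v = isVertexᵇ u ∧ isVertexᵇ v ∧ (∣ u ∩ v ∣ ≡ᵇ 2)

tri : {n : ℕ} → Fin n → Fin n → Fin n → Subset n
tri x y z = ⁅ x ⁆ ∪ (⁅ y ⁆ ∪ ⁅ z ⁆)

-- A 2-partition {X1, X2} of V(J(n,3)) is given by χ : X1 = {v | χ v ≡ true},
-- X2 = {v | χ v ≡ false} (values of χ on non-3-subsets are irrelevant).

_==ᵇ_ : Bool → Bool → Bool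
true ==ᵇ true = true
false ==ᵇ false = true
_ ==ᵇ _ = false

nbrsIn : {n : ℕ} → (Subset n → Bool) → Bool → Subset n → ℕ
nbrsIn {n} χ b u = countB (λ v → adjᵇ u v ∧ (χ v ==ᵇ b)) (allSubsets n)

record IsEquitable2 (n : ℕ) (χ : Subset n → Bool) (p11 p12 p21 p22 : ℕ) : Set where
  field
    X1-nonempty : ∃[ v ] (∣ v ∣ ≡ 3 × χ v ≡ true)
    X2-nonempty : ∃[ v ] (∣ v ∣ ≡ 3 × χ v ≡ false)
    row1 : ∀ u → ∣ u ∣ ≡ 3 → χ u ≡ true →
           nbrsIn χ true u ≡ p11 × nbrsIn χ false u ≡ p12
    row2 : ∀ u → ∣ u ∣ ≡ 3 → χ u ≡ false →
           nbrsIn χ true u ≡ p21 × nbrsIn χ false u ≡ p22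

-- λ₂-equitable: p11 - p21 = n - 7 (as integers), written without subtraction.
IsLambda2 : ℕ → ℕ → ℕ → Set
IsLambda2 n p11 p21 = p11 + 7 ≡ p21 + n

pairCount : {n : ℕ} → (Subset n → Bool) → Fin n → Fin n → ℕ
pairCount {n} χ i j =
  countB (λ v → isVertexᵇ v ∧ (i ∈ᵇ v) ∧ (j ∈ᵇ v) ∧ χ v) (allSubsets n)

Distinct3 : {n : ℕ} → Fin n → Fin n → Fin n → Set
Distinct3 x y z = x ≢ y × x ≢ z × y ≢ z

-- v ∈ X1 is of type (I) / (II): there is a labelling v = {x,y,z} with
-- xy* ≥ xz* ≥ yz* and the difference pair equal to (n-4, 0), resp.
-- ((n-4)/2, (n-4)/2); "d = (n-4)/2" is written 2d + 4 = n (impossible for odd n).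
TypeI : (n : ℕ) → (Subset n → Bool) → Subset n → Set
TypeI n χ v = χ v ≡ true × ∣ v ∣ ≡ 3 ×
  ∃[ x ] ∃[ y ] ∃[ z ] (Distinct3 x y z × v ≡ tri x y z ×
    pairCount χ x z ≤ pairCount χ x y × pairCount χ y z ≤ pairCount χ x z ×
    pairCount χ x y ∸ pairCount χ x z ≡ n ∸ 4 ×
    pairCount χ x z ∸ pairCount χ y z ≡ 0)

TypeII : (n : ℕ) → (Subset n → Bool) → Subset n → Set
TypeII n χ v = χ v ≡ true × ∣ v ∣ ≡ 3 ×
  ∃[ x ] ∃[ y ] ∃[ z ] (Distinct3 x y z × v ≡ tri x y z ×
    pairCount χ x z ≤ pairCount χ x y × pairCount χ y z ≤ pairCount χ x z ×
    2 * (pairCount χ x y ∸ pairCount χ x z) + 4 ≡ n ×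
    2 * (pairCount χ x z ∸ pairCount χ y z) + 4 ≡ n)

-- For a vertex {x,y,z} of J(n,3), each neighbour in X₁ contains exactly one of the pairs xy, xz, yz,
-- so xy* + xz* + yz* is p₁₁ + 3 when the vertex lies in X₁ and p₂₁ otherwise.  For {a,b,c} this and
-- 2n ≤ p₁₁ + 7 force ab* = n − 2.  For d of type (1,1,1) the identities for {a,b,d}, {a,c,d},
-- {b,c,d} give ad* = bd* = ac* and cd* = ab* = n − 2, so every triple through c and d lies in X₁.
-- If some e is of type (1,0,0), λ₂-equitability gives ce* = ab* + 4 − n, and each z ≠ b counted by
-- ac* is of type (1,1,1), hence counted by ce*; so ac* ≤ 1 + ce*, which with ab* − ac* = (n − 4)/2
-- yields n ≤ 6.  Otherwise ac* = n − 2 ≥ ab*, and n ≤ 4.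
module Submission where

open import Defs
open import Data.Nat using (ℕ; _+_; _*_; _≤_)
open import Data.Bool using (Bool; true; false)
open import Data.Fin using (Fin)
open import Data.Fin.Subset using (Subset)
open import Data.Product using (_×_)
open import Data.Sum using (_⊎_)
open import Relation.Nullary using (¬_)
open import Relation.Binary.PropositionalEquality using (_≡_; _≢_)

open import Function using (_∘_; id)
open import Data.Nat using (zero; suc; z≤n; s≤s; _≡ᵇ_)
open import Data.Nat.Properties hiding (_≟_)
open import Data.Nat.Tactic.RingSolver using (solve-∀)
open import Algebra.Properties.CommutativeSemigroup +-commutativeSemigroup
  using () renaming (interchange to +-interchange)
open import Data.Bool using (_∧_; _∨_; not; T)
open import Data.Bool.Properties using (∧-zeroʳ; ∧-identityʳ; ∧-distribˡ-∨) renaming (_≟_ to _≟ᵇ_)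
open import Data.Fin using (zero; suc; _≟_)
open import Data.Fin.Properties using (any?)
open import Data.Fin.Subset using (inside; outside; _∩_; _∪_; ⁅_⁆; ∣_∣; ⊥)
open import Data.Fin.Subset.Properties
  using (∪-identityʳ; ∪-assoc; ∪-comm; ∣p∩q∣≤∣p∣; ∣p∩q∣≤∣q∣; ∣⁅x⁆∣≡1)
open import Data.Vec using ([]; _∷_; lookup)
open import Data.Vec.Properties using (lookup-replicate; lookup-zipWith)
open import Data.List using (List; []; _∷_; map; _++_; allFin; length)
open import Data.List.Properties using (map-tabulate; length-tabulate)
open import Data.List.Membership.Propositional using (_∈_)
open import Data.List.Membership.Propositional.Properties using (∈-allFin)
open import Data.List.Relation.Unary.Any using (here; there)
open import Data.Product using (_,_; uncurry; proj₁; proj₂)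
open import Data.Sum using (inj₁; inj₂)
open import Relation.Nullary using (does; yes; no; contradiction; ¬?; _×-dec_)
open import Relation.Binary.PropositionalEquality
  using (refl; sym; trans; cong; cong₂; subst; subst₂; ≢-sym; module ≡-Reasoning)

ind : Bool → ℕ
ind true  = 1
ind false = 0

∑ : {A : Set} → (A → ℕ) → List A → ℕ
∑ f []       = 0
∑ f (x ∷ xs) = f x + ∑ f xs

module _ {A : Set} where

  countB≡∑ind : (p : A → Bool) (xs : List A) → countB p xs ≡ ∑ (ind ∘ p) xs
  countB≡∑ind p [] = refl
  countB≡∑ind p (x ∷ xs) with p x
  ... | true  = cong suc (countB≡∑ind p xs)
  ... | false = countB≡∑ind p xs

  ∑-cong : {f g : A → ℕ} → (∀ x → f x ≡ g x) → (xs : List A) → ∑ f xs ≡ ∑ g xs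
  ∑-cong f≡g []       = refl
  ∑-cong f≡g (x ∷ xs) = cong₂ _+_ (f≡g x) (∑-cong f≡g xs)

  ∑-mono-≤ : {f g : A → ℕ} → (∀ x → f x ≤ g x) → (xs : List A) → ∑ f xs ≤ ∑ g xs
  ∑-mono-≤ f≤g []       = z≤n
  ∑-mono-≤ f≤g (x ∷ xs) = +-mono-≤ (f≤g x) (∑-mono-≤ f≤g xs)

  ∑-distrib-+ : (f g : A → ℕ) (xs : List A) → ∑ (λ x → f x + g x) xs ≡ ∑ f xs + ∑ g xs
  ∑-distrib-+ f g []       = refl
  ∑-distrib-+ f g (x ∷ xs) =
    trans (cong (f x + g x +_) (∑-distrib-+ f g xs)) (+-interchange (f x) (g x) (∑ f xs) (∑ g xs))

  *-distribˡ-∑ : (k : ℕ) (f : A → ℕ) (xs : List A) → k * ∑ f xs ≡ ∑ (λ x → k * f x) xs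
  *-distribˡ-∑ k f []       = *-zeroʳ k
  *-distribˡ-∑ k f (x ∷ xs) = trans (*-distribˡ-+ k (f x) (∑ f xs)) (cong (k * f x +_) (*-distribˡ-∑ k f xs))

  ∑-++ : (f : A → ℕ) (xs ys : List A) → ∑ f (xs ++ ys) ≡ ∑ f xs + ∑ f ys
  ∑-++ f []       ys = refl
  ∑-++ f (x ∷ xs) ys = trans (cong (f x +_) (∑-++ f xs ys)) (sym (+-assoc (f x) _ _))

  ∑-zero : {f : A → ℕ} → (∀ x → f x ≡ 0) → (xs : List A) → ∑ f xs ≡ 0
  ∑-zero f≡0 []       = refl
  ∑-zero f≡0 (x ∷ xs) = cong₂ _+_ (f≡0 x) (∑-zero f≡0 xs)

  ∑-const-1 : (xs : List A) → ∑ (λ _ → 1) xs ≡ length xs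
  ∑-const-1 []       = refl
  ∑-const-1 (x ∷ xs) = cong suc (∑-const-1 xs)

∑-map : {A B : Set} (f : B → ℕ) (g : A → B) (xs : List A) → ∑ f (map g xs) ≡ ∑ (f ∘ g) xs
∑-map f g []       = refl
∑-map f g (x ∷ xs) = cong (f (g x) +_) (∑-map f g xs)

∑-allFin-suc : ∀ {n} (f : Fin (suc n) → ℕ) → ∑ f (allFin (suc n)) ≡ f zero + ∑ (f ∘ suc) (allFin n)
∑-allFin-suc {n} f = cong (f zero +_) (trans (cong (∑ f) (sym (map-tabulate id suc))) (∑-map f suc (allFin n)))

ind-∧-≤ : ∀ a b → ind (a ∧ b) ≤ ind a
ind-∧-≤ true  true  = ≤-refl
ind-∧-≤ true  false = z≤n
ind-∧-≤ false b     = z≤n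

ind-∨-disjoint : ∀ a b c → a ∧ b ≡ false → ind ((a ∨ b) ∧ c) ≡ ind (a ∧ c) + ind (b ∧ c)
ind-∨-disjoint true  true  c     ()
ind-∨-disjoint true  false true  _ = refl
ind-∨-disjoint true  false false _ = refl
ind-∨-disjoint false b     c     _ = refl

ind-not+ind : ∀ a → ind (not a) + ind a ≡ 1
ind-not+ind true  = refl
ind-not+ind false = refl

∑ind-∧-≥⇒ : {A : Set} (f g : A → Bool) {xs : List A} →
  ∑ (ind ∘ f) xs ≤ ∑ (λ x → ind (f x ∧ g x)) xs →
  ∀ {x} → x ∈ xs → f x ≡ true → g x ≡ true
∑ind-∧-≥⇒ f g {x ∷ xs} le (here refl) fx with f x | g x
... | true | true  = refl
... | true | false = contradiction (≤-trans le (∑-mono-≤ (λ y → ind-∧-≤ (f y) (g y)) xs)) (n≮n _)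
∑ind-∧-≥⇒ f g {x ∷ xs} le (there x∈xs) fx = ∑ind-∧-≥⇒ f g tail≤ x∈xs fx
  where
  tail≤ : ∑ (ind ∘ f) xs ≤ ∑ (λ y → ind (f y ∧ g y)) xs
  tail≤ = +-cancelˡ-≤ (ind (f x)) _ _ (≤-trans le (+-monoˡ-≤ _ (ind-∧-≤ (f x) (g x))))

lookup-⁅⁆ : ∀ {n} (x i : Fin n) → lookup ⁅ x ⁆ i ≡ does (i ≟ x)
lookup-⁅⁆ zero    zero    = refl
lookup-⁅⁆ zero    (suc i) = lookup-replicate i false
lookup-⁅⁆ (suc x) zero    = refl
lookup-⁅⁆ (suc x) (suc i) = lookup-⁅⁆ x i

lookup-∪ : ∀ {n} (p q : Subset n) i → lookup (p ∪ q) i ≡ lookup p i ∨ lookup q i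
lookup-∪ p q i = lookup-zipWith _∨_ i p q

lookup-∩ : ∀ {n} (p q : Subset n) i → lookup (p ∩ q) i ≡ lookup p i ∧ lookup q i
lookup-∩ p q i = lookup-zipWith _∧_ i p q

⁅⁆-disjoint : ∀ {n} {x y : Fin n} → x ≢ y → ∀ i → lookup ⁅ x ⁆ i ∧ lookup ⁅ y ⁆ i ≡ false
⁅⁆-disjoint {x = x} {y} x≢y i rewrite lookup-⁅⁆ x i | lookup-⁅⁆ y i with i ≟ x | i ≟ y
... | yes refl | yes refl = contradiction refl x≢y
... | yes _    | no _     = refl
... | no _     | _        = refl

∉-pair : ∀ {n} {i j z : Fin n} → z ≢ i → z ≢ j → not (lookup (⁅ i ⁆ ∪ ⁅ j ⁆) z) ≡ true
∉-pair {i = i} {j} {z} z≢i z≢j rewrite lookup-∪ ⁅ i ⁆ ⁅ j ⁆ z | lookup-⁅⁆ i z | lookup-⁅⁆ j z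
  with z ≟ i | z ≟ j
... | yes z≡i | _       = contradiction z≡i z≢i
... | no _    | yes z≡j = contradiction z≡j z≢j
... | no _    | no _    = refl

∉-pair⁻ : ∀ {n} (i j : Fin n) {z : Fin n} → not (lookup (⁅ i ⁆ ∪ ⁅ j ⁆) z) ≡ true → z ≢ i × z ≢ j
∉-pair⁻ i j {z} z∉ rewrite lookup-∪ ⁅ i ⁆ ⁅ j ⁆ z | lookup-⁅⁆ i z | lookup-⁅⁆ j z
  with z ≟ i | z ≟ j | z∉
... | no z≢i | no z≢j | _ = z≢i , z≢j

∣p∣≡∑ : ∀ {n} (p : Subset n) → ∣ p ∣ ≡ ∑ (ind ∘ lookup p) (allFin n)
∣p∣≡∑ []          = refl
∣p∣≡∑ (true  ∷ p) = trans (cong suc (∣p∣≡∑ p)) (sym (∑-allFin-suc (ind ∘ lookup (true ∷ p))))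
∣p∣≡∑ (false ∷ p) = trans (∣p∣≡∑ p) (sym (∑-allFin-suc (ind ∘ lookup (false ∷ p))))

∑-∉+∣p∣≡n : ∀ {n} (p : Subset n) → ∑ (λ i → ind (not (lookup p i))) (allFin n) + ∣ p ∣ ≡ n
∑-∉+∣p∣≡n {n} p = begin
  ∑ (λ i → ind (not (lookup p i))) (allFin n) + ∣ p ∣
    ≡⟨ cong (∑ (λ i → ind (not (lookup p i))) (allFin n) +_) (∣p∣≡∑ p) ⟩
  ∑ (λ i → ind (not (lookup p i))) (allFin n) + ∑ (ind ∘ lookup p) (allFin n)
    ≡⟨ sym (∑-distrib-+ _ _ (allFin n)) ⟩
  ∑ (λ i → ind (not (lookup p i)) + ind (lookup p i)) (allFin n)
    ≡⟨ ∑-cong (ind-not+ind ∘ lookup p) (allFin n) ⟩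
  ∑ (λ _ → 1) (allFin n)
    ≡⟨ trans (∑-const-1 (allFin n)) (length-tabulate id) ⟩
  n ∎
  where open ≡-Reasoning

weight : ∀ {n} → Subset n → (Fin n → Bool) → ℕ
weight {n} p g = ∑ (λ i → ind (lookup p i ∧ g i)) (allFin n)

weight-⁅⁆ : ∀ {n} (x : Fin n) (g : Fin n → Bool) → weight ⁅ x ⁆ g ≡ ind (g x)
weight-⁅⁆ {suc n} zero g = trans (∑-allFin-suc (λ i → ind (lookup ⁅ zero ⁆ i ∧ g i)))
  (trans (cong (ind (g zero) +_) (∑-zero ⊥-part (allFin n))) (+-identityʳ _))
  where
  ⊥-part : ∀ i → ind (lookup ⊥ i ∧ g (suc i)) ≡ 0
  ⊥-part i = cong (λ b → ind (b ∧ g (suc i))) (lookup-replicate i false)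
weight-⁅⁆ {suc n} (suc x) g =
  trans (∑-allFin-suc (λ i → ind (lookup ⁅ suc x ⁆ i ∧ g i))) (weight-⁅⁆ x (g ∘ suc))

weight-∪ : ∀ {n} (p q : Subset n) (g : Fin n → Bool) → (∀ i → lookup p i ∧ lookup q i ≡ false) →
  weight (p ∪ q) g ≡ weight p g + weight q g
weight-∪ {n} p q g disjoint = trans (∑-cong split-i (allFin n)) (∑-distrib-+ _ _ (allFin n))
  where
  split-i : ∀ i → ind (lookup (p ∪ q) i ∧ g i) ≡ ind (lookup p i ∧ g i) + ind (lookup q i ∧ g i)
  split-i i = trans (cong (λ b → ind (b ∧ g i)) (lookup-∪ p q i))
                    (ind-∨-disjoint (lookup p i) (lookup q i) (g i) (disjoint i))

weight-pair : ∀ {n} {x y : Fin n} (g : Fin n → Bool) → x ≢ y →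
  weight (⁅ x ⁆ ∪ ⁅ y ⁆) g ≡ ind (g x) + ind (g y)
weight-pair {x = x} {y} g x≢y =
  trans (weight-∪ ⁅ x ⁆ ⁅ y ⁆ g (⁅⁆-disjoint x≢y)) (cong₂ _+_ (weight-⁅⁆ x g) (weight-⁅⁆ y g))

weight-tri : ∀ {n} {x y z : Fin n} (g : Fin n → Bool) → Distinct3 x y z →
  weight (tri x y z) g ≡ ind (g x) + (ind (g y) + ind (g z))
weight-tri {x = x} {y} {z} g (x≢y , x≢z , y≢z) =
  trans (weight-∪ ⁅ x ⁆ (⁅ y ⁆ ∪ ⁅ z ⁆) g disjoint) (cong₂ _+_ (weight-⁅⁆ x g) (weight-pair g y≢z))
  where
  disjoint : ∀ i → lookup ⁅ x ⁆ i ∧ lookup (⁅ y ⁆ ∪ ⁅ z ⁆) i ≡ false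
  disjoint i rewrite lookup-∪ ⁅ y ⁆ ⁅ z ⁆ i | ∧-distribˡ-∨ (lookup ⁅ x ⁆ i) (lookup ⁅ y ⁆ i) (lookup ⁅ z ⁆ i)
                   | ⁅⁆-disjoint x≢y i | ⁅⁆-disjoint x≢z i = refl

∣p∣≡weight : ∀ {n} (p : Subset n) → ∣ p ∣ ≡ weight p (λ _ → true)
∣p∣≡weight {n} p = trans (∣p∣≡∑ p) (∑-cong (λ i → cong ind (sym (∧-identityʳ (lookup p i)))) (allFin n))

∣p∩q∣≡weight : ∀ {n} (p q : Subset n) → ∣ p ∩ q ∣ ≡ weight p (lookup q)
∣p∩q∣≡weight {n} p q = trans (∣p∣≡∑ (p ∩ q)) (∑-cong (cong ind ∘ lookup-∩ p q) (allFin n))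

∣pair∣≡2 : ∀ {n} {x y : Fin n} → x ≢ y → ∣ ⁅ x ⁆ ∪ ⁅ y ⁆ ∣ ≡ 2
∣pair∣≡2 {x = x} {y} x≢y = trans (∣p∣≡weight (⁅ x ⁆ ∪ ⁅ y ⁆)) (weight-pair (λ _ → true) x≢y)

∣tri∣≡3 : ∀ {n} {x y z : Fin n} → Distinct3 x y z → ∣ tri x y z ∣ ≡ 3
∣tri∣≡3 {x = x} {y} {z} d = trans (∣p∣≡weight (tri x y z)) (weight-tri (λ _ → true) d)

∣tri∩w∣ : ∀ {n} {x y z : Fin n} → Distinct3 x y z → (w : Subset n) →
  ∣ tri x y z ∩ w ∣ ≡ ind (lookup w x) + (ind (lookup w y) + ind (lookup w z))
∣tri∩w∣ {x = x} {y} {z} d w = trans (∣p∩q∣≡weight (tri x y z) w) (weight-tri (lookup w) d)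

≡ᵇ-false : ∀ {m n} → m ≢ n → (m ≡ᵇ n) ≡ false
≡ᵇ-false {m} {n} m≢n with m ≡ᵇ n in eq
... | true  = contradiction (≡ᵇ⇒≡ m n (subst T (sym eq) _)) m≢n
... | false = refl

∑-allSubsets-suc : ∀ {n} (f : Subset (suc n) → ℕ) →
  ∑ f (allSubsets (suc n)) ≡ ∑ (f ∘ (true ∷_)) (allSubsets n) + ∑ (f ∘ (false ∷_)) (allSubsets n)
∑-allSubsets-suc {n} f = trans (∑-++ f (map (inside ∷_) (allSubsets n)) (map (outside ∷_) (allSubsets n)))
  (cong₂ _+_ (∑-map f (inside ∷_) (allSubsets n)) (∑-map f (outside ∷_) (allSubsets n)))

supersetWith : ∀ {n} → ℕ → Subset n → (Subset n → Bool) → Subset n → Bool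
supersetWith k S P w = (∣ w ∣ ≡ᵇ k) ∧ ((∣ S ∩ w ∣ ≡ᵇ ∣ S ∣) ∧ P w)

∑-supersets-same-size : ∀ {n} (S : Subset n) (P : Subset n → Bool) →
  ∑ (ind ∘ supersetWith ∣ S ∣ S P) (allSubsets n) ≡ ind (P S)
∑-supersets-same-size [] P = +-identityʳ _
∑-supersets-same-size {suc n} (true ∷ S) P =
  trans (∑-allSubsets-suc (ind ∘ supersetWith ∣ true ∷ S ∣ (true ∷ S) P))
  (trans (cong₂ _+_ (∑-supersets-same-size S (P ∘ (true ∷_))) (∑-zero misses-head (allSubsets n)))
         (+-identityʳ _))
  where
  misses-head : ∀ w → ind ((∣ w ∣ ≡ᵇ suc ∣ S ∣) ∧ ((∣ S ∩ w ∣ ≡ᵇ suc ∣ S ∣) ∧ P (false ∷ w))) ≡ 0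
  misses-head w rewrite ≡ᵇ-false (<⇒≢ (s≤s (∣p∩q∣≤∣p∣ S w))) = cong ind (∧-zeroʳ _)
∑-supersets-same-size {suc n} (false ∷ S) P =
  trans (∑-allSubsets-suc (ind ∘ supersetWith ∣ false ∷ S ∣ (false ∷ S) P))
  (cong₂ _+_ (∑-zero too-large (allSubsets n)) (∑-supersets-same-size S (P ∘ (false ∷_))))
  where
  too-large : ∀ w → ind ((suc ∣ w ∣ ≡ᵇ ∣ S ∣) ∧ ((∣ S ∩ w ∣ ≡ᵇ ∣ S ∣) ∧ P (true ∷ w))) ≡ 0
  too-large w with ∣ S ∩ w ∣ ≡ᵇ ∣ S ∣ in S⊆w
  ... | false = cong ind (∧-zeroʳ _)
  ... | true = cong (λ b → ind (b ∧ P (true ∷ w))) (≡ᵇ-false (>⇒≢ (s≤s ∣S∣≤∣w∣)))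
    where
    ∣S∣≤∣w∣ : ∣ S ∣ ≤ ∣ w ∣
    ∣S∣≤∣w∣ = subst (_≤ ∣ w ∣) (≡ᵇ⇒≡ _ _ (subst T (sym S⊆w) _)) (∣p∩q∣≤∣q∣ S w)

∑-supersets-one-larger : ∀ {n} (S : Subset n) (P : Subset n → Bool) →
  ∑ (ind ∘ supersetWith (suc ∣ S ∣) S P) (allSubsets n)
  ≡ ∑ (λ z → ind (not (lookup S z) ∧ P (S ∪ ⁅ z ⁆))) (allFin n)
∑-supersets-one-larger [] P = refl
∑-supersets-one-larger {suc n} (true ∷ S) P =
  trans (∑-allSubsets-suc (ind ∘ supersetWith (suc ∣ true ∷ S ∣) (true ∷ S) P))
  (trans (cong₂ _+_ (∑-supersets-one-larger S (P ∘ (true ∷_))) (∑-zero misses-head (allSubsets n)))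
  (trans (+-identityʳ _)
         (sym (∑-allFin-suc (λ z → ind (not (lookup (true ∷ S) z) ∧ P ((true ∷ S) ∪ ⁅ z ⁆)))))))
  where
  misses-head : ∀ w → ind ((∣ w ∣ ≡ᵇ suc (suc ∣ S ∣)) ∧ ((∣ S ∩ w ∣ ≡ᵇ suc ∣ S ∣) ∧ P (false ∷ w))) ≡ 0
  misses-head w rewrite ≡ᵇ-false (<⇒≢ (s≤s (∣p∩q∣≤∣p∣ S w))) = cong ind (∧-zeroʳ _)
∑-supersets-one-larger {suc n} (false ∷ S) P =
  trans (∑-allSubsets-suc (ind ∘ supersetWith (suc ∣ false ∷ S ∣) (false ∷ S) P))
  (trans (cong₂ _+_ (∑-supersets-same-size S (P ∘ (true ∷_))) (∑-supersets-one-larger S (P ∘ (false ∷_))))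
  (trans (cong (λ S′ → ind (P (true ∷ S′)) + ∑ (λ z → ind (not (lookup S z) ∧ P (false ∷ (S ∪ ⁅ z ⁆)))) (allFin n))
               (sym (∪-identityʳ S)))
         (sym (∑-allFin-suc (λ z → ind (not (lookup (false ∷ S) z) ∧ P ((false ∷ S) ∪ ⁅ z ⁆)))))))

ind-both : ∀ a b c → a ∧ (b ∧ c) ≡ ((ind a + ind b ≡ᵇ 2) ∧ c)
ind-both true  true  c = refl
ind-both true  false c = refl
ind-both false true  c = refl
ind-both false false c = refl

pairCount≡∑ : ∀ {n} (χ : Subset n → Bool) {i j : Fin n} → i ≢ j →
  pairCount χ i j ≡ ∑ (λ z → ind (not (lookup (⁅ i ⁆ ∪ ⁅ j ⁆) z) ∧ χ (tri i j z))) (allFin n)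
pairCount≡∑ {n} χ {i} {j} i≢j = begin
  pairCount χ i j
    ≡⟨ countB≡∑ind _ (allSubsets n) ⟩
  ∑ (λ w → ind (isVertexᵇ w ∧ (lookup w i ∧ (lookup w j ∧ χ w)))) (allSubsets n)
    ≡⟨ ∑-cong as-superset (allSubsets n) ⟩
  ∑ (ind ∘ supersetWith (suc ∣ ij ∣) ij χ) (allSubsets n)
    ≡⟨ ∑-supersets-one-larger ij χ ⟩
  ∑ (λ z → ind (not (lookup ij z) ∧ χ (ij ∪ ⁅ z ⁆))) (allFin n)
    ≡⟨ ∑-cong (λ z → cong (λ v → ind (not (lookup ij z) ∧ χ v)) (∪-assoc ⁅ i ⁆ ⁅ j ⁆ ⁅ z ⁆)) (allFin n) ⟩
  ∑ (λ z → ind (not (lookup ij z) ∧ χ (tri i j z))) (allFin n) ∎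
  where
  open ≡-Reasoning
  ij = ⁅ i ⁆ ∪ ⁅ j ⁆
  as-superset : ∀ w → ind (isVertexᵇ w ∧ (lookup w i ∧ (lookup w j ∧ χ w)))
                    ≡ ind (supersetWith (suc ∣ ij ∣) ij χ w)
  as-superset w rewrite ∣pair∣≡2 i≢j | ∣p∩q∣≡weight ij w | weight-pair (lookup w) i≢j =
    cong (λ b → ind (isVertexᵇ w ∧ b)) (ind-both (lookup w i) (lookup w j) (χ w))

∑-∉pair+2≡n : ∀ {n} {i j : Fin n} → i ≢ j →
  ∑ (λ z → ind (not (lookup (⁅ i ⁆ ∪ ⁅ j ⁆) z))) (allFin n) + 2 ≡ n
∑-∉pair+2≡n {n} {i} {j} i≢j =
  subst (λ k → ∑ (λ z → ind (not (lookup (⁅ i ⁆ ∪ ⁅ j ⁆) z))) (allFin n) + k ≡ n)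
        (∣pair∣≡2 i≢j) (∑-∉+∣p∣≡n (⁅ i ⁆ ∪ ⁅ j ⁆))

pairCount+2≤n : ∀ {n} (χ : Subset n → Bool) {i j : Fin n} → i ≢ j → pairCount χ i j + 2 ≤ n
pairCount+2≤n {n} χ {i} {j} i≢j = subst (pairCount χ i j + 2 ≤_) (∑-∉pair+2≡n i≢j)
  (+-monoˡ-≤ 2 (subst (_≤ _) (sym (pairCount≡∑ χ i≢j))
    (∑-mono-≤ (λ z → ind-∧-≤ (not (lookup (⁅ i ⁆ ∪ ⁅ j ⁆) z)) (χ (tri i j z))) (allFin n))))

pairCount-full⁺ : ∀ {n} (χ : Subset n → Bool) {i j : Fin n} → i ≢ j →
  (∀ z → z ≢ i → z ≢ j → χ (tri i j z) ≡ true) → pairCount χ i j + 2 ≡ n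
pairCount-full⁺ {n} χ {i} {j} i≢j full = begin
  pairCount χ i j + 2
    ≡⟨ cong (_+ 2) (trans (pairCount≡∑ χ i≢j) (∑-cong in-X₁ (allFin n))) ⟩
  ∑ (λ z → ind (not (lookup (⁅ i ⁆ ∪ ⁅ j ⁆) z))) (allFin n) + 2
    ≡⟨ ∑-∉pair+2≡n i≢j ⟩
  n ∎
  where
  open ≡-Reasoning
  in-X₁ : ∀ z → ind (not (lookup (⁅ i ⁆ ∪ ⁅ j ⁆) z) ∧ χ (tri i j z)) ≡ ind (not (lookup (⁅ i ⁆ ∪ ⁅ j ⁆) z))
  in-X₁ z with not (lookup (⁅ i ⁆ ∪ ⁅ j ⁆) z) in z∉
  ... | false = refl
  ... | true  = cong ind (uncurry (full z) (∉-pair⁻ i j z∉))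

pairCount-full⁻ : ∀ {n} (χ : Subset n → Bool) {i j : Fin n} → i ≢ j →
  n ≤ pairCount χ i j + 2 → ∀ z → z ≢ i → z ≢ j → χ (tri i j z) ≡ true
pairCount-full⁻ {n} χ {i} {j} i≢j n≤ z z≢i z≢j =
  ∑ind-∧-≥⇒ (λ z → not (lookup (⁅ i ⁆ ∪ ⁅ j ⁆) z)) (χ ∘ tri i j) count≤ (∈-allFin z) (∉-pair z≢i z≢j)
  where
  count≤ : ∑ (λ z → ind (not (lookup (⁅ i ⁆ ∪ ⁅ j ⁆) z))) (allFin n)
         ≤ ∑ (λ z → ind (not (lookup (⁅ i ⁆ ∪ ⁅ j ⁆) z) ∧ χ (tri i j z))) (allFin n)
  count≤ = +-cancelʳ-≤ 2 _ _ (subst₂ _≤_ (sym (∑-∉pair+2≡n i≢j)) (cong (_+ 2) (pairCount≡∑ χ i≢j)) n≤)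

ind≤1 : ∀ a → ind a ≤ 1
ind≤1 true  = ≤-refl
ind≤1 false = z≤n

pairCount≤1+pairCount : ∀ {n} (χ : Subset n → Bool) {i j k l : Fin n} (b : Fin n) → i ≢ j → k ≢ l →
  (∀ z → z ≢ i → z ≢ j → z ≢ b → χ (tri i j z) ≡ true → z ≢ k × z ≢ l × χ (tri k l z) ≡ true) →
  pairCount χ i j ≤ 1 + pairCount χ k l
pairCount≤1+pairCount {n} χ {i} {j} {k} {l} b i≢j k≢l covered = begin
  pairCount χ i j
    ≡⟨ pairCount≡∑ χ i≢j ⟩
  ∑ (λ z → ind (not (lookup (⁅ i ⁆ ∪ ⁅ j ⁆) z) ∧ χ (tri i j z))) (allFin n)
    ≤⟨ ∑-mono-≤ pointwise (allFin n) ⟩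
  ∑ (λ z → ind (lookup ⁅ b ⁆ z) + ind (not (lookup (⁅ k ⁆ ∪ ⁅ l ⁆) z) ∧ χ (tri k l z))) (allFin n)
    ≡⟨ ∑-distrib-+ _ _ (allFin n) ⟩
  ∑ (ind ∘ lookup ⁅ b ⁆) (allFin n) + ∑ (λ z → ind (not (lookup (⁅ k ⁆ ∪ ⁅ l ⁆) z) ∧ χ (tri k l z))) (allFin n)
    ≡⟨ cong₂ _+_ (trans (sym (∣p∣≡∑ ⁅ b ⁆)) (∣⁅x⁆∣≡1 b)) (sym (pairCount≡∑ χ k≢l)) ⟩
  1 + pairCount χ k l ∎
  where
  open ≤-Reasoning
  pointwise : ∀ z → ind (not (lookup (⁅ i ⁆ ∪ ⁅ j ⁆) z) ∧ χ (tri i j z))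
                  ≤ ind (lookup ⁅ b ⁆ z) + ind (not (lookup (⁅ k ⁆ ∪ ⁅ l ⁆) z) ∧ χ (tri k l z))
  pointwise z rewrite lookup-⁅⁆ b z with z ≟ b
  ... | yes _ = ≤-trans (ind≤1 _) (m≤m+n 1 _)
  ... | no z≢b with not (lookup (⁅ i ⁆ ∪ ⁅ j ⁆) z) in z∉ | χ (tri i j z) in ijz∈X₁
  ...   | false | _     = z≤n
  ...   | true  | false = z≤n
  ...   | true  | true  with covered z (proj₁ (∉-pair⁻ i j z∉)) (proj₂ (∉-pair⁻ i j z∉)) z≢b ijz∈X₁
  ...     | z≢k , z≢l , klz∈X₁ rewrite ∉-pair z≢k z≢l | klz∈X₁ = ≤-refl

pairs-in-triple : ∀ V X Y Z c →
  ind ((V ∧ ((ind X + (ind Y + ind Z)) ≡ᵇ 2)) ∧ (c ==ᵇ true))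
    + 3 * ind (V ∧ (((ind X + (ind Y + ind Z)) ≡ᵇ 3) ∧ c))
  ≡ ind (V ∧ (X ∧ (Y ∧ c))) + ind (V ∧ (X ∧ (Z ∧ c))) + ind (V ∧ (Y ∧ (Z ∧ c)))
pairs-in-triple false X     Y     Z     c     = refl
pairs-in-triple true  true  true  true  true  = refl
pairs-in-triple true  true  true  true  false = refl
pairs-in-triple true  true  true  false true  = refl
pairs-in-triple true  true  true  false false = refl
pairs-in-triple true  true  false true  true  = refl
pairs-in-triple true  true  false true  false = refl
pairs-in-triple true  true  false false true  = refl
pairs-in-triple true  true  false false false = refl
pairs-in-triple true  false true  true  true  = refl
pairs-in-triple true  false true  true  false = refl
pairs-in-triple true  false true  false true  = refl
pairs-in-triple true  false true  false false = refl
pairs-in-triple true  false false true  true  = refl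
pairs-in-triple true  false false true  false = refl
pairs-in-triple true  false false false true  = refl
pairs-in-triple true  false false false false = refl

-- Double counting: a vertex w of X₁ adjacent to v = {x,y,z} contains exactly one of the pairs
-- of v, and v itself contains all three.
nbrsIn-tri : ∀ {n} (χ : Subset n → Bool) {x y z : Fin n} → Distinct3 x y z →
  nbrsIn χ true (tri x y z) + 3 * ind (χ (tri x y z))
  ≡ pairCount χ x y + pairCount χ x z + pairCount χ y z
nbrsIn-tri {n} χ {x} {y} {z} d = begin
  nbrsIn χ true v + 3 * ind (χ v)
    ≡⟨ cong₂ _+_ (countB≡∑ind _ L) (cong (3 *_) (sym (∑-supersets-same-size v χ))) ⟩
  ∑ adjacent L + 3 * ∑ equal L
    ≡⟨ cong (∑ adjacent L +_) (*-distribˡ-∑ 3 equal L) ⟩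
  ∑ adjacent L + ∑ (λ w → 3 * equal w) L
    ≡⟨ sym (∑-distrib-+ adjacent (λ w → 3 * equal w) L) ⟩
  ∑ (λ w → adjacent w + 3 * equal w) L
    ≡⟨ ∑-cong (λ w → pairs-in w) L ⟩
  ∑ (λ w → through x y w + through x z w + through y z w) L
    ≡⟨ ∑-distrib-+ (λ w → through x y w + through x z w) (through y z) L ⟩
  ∑ (λ w → through x y w + through x z w) L + ∑ (through y z) L
    ≡⟨ cong (_+ ∑ (through y z) L) (∑-distrib-+ (through x y) (through x z) L) ⟩
  ∑ (through x y) L + ∑ (through x z) L + ∑ (through y z) L
    ≡⟨ sym (cong₂ _+_ (cong₂ _+_ (countB≡∑ind _ L) (countB≡∑ind _ L)) (countB≡∑ind _ L)) ⟩
  pairCount χ x y + pairCount χ x z + pairCount χ y z ∎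
  where
  open ≡-Reasoning
  v = tri x y z
  L = allSubsets n
  adjacent equal : Subset n → ℕ
  adjacent w = ind (adjᵇ v w ∧ (χ w ==ᵇ true))
  equal w = ind (supersetWith ∣ v ∣ v χ w)
  through : Fin n → Fin n → Subset n → ℕ
  through i j w = ind (isVertexᵇ w ∧ (lookup w i ∧ (lookup w j ∧ χ w)))
  pairs-in : ∀ w → adjacent w + 3 * equal w ≡ through x y w + through x z w + through y z w
  pairs-in w rewrite ∣tri∩w∣ d w | ∣tri∣≡3 d =
    pairs-in-triple (isVertexᵇ w) (lookup w x) (lookup w y) (lookup w z) (χ w)

tri-swap₂₃ : ∀ {n} (x y z : Fin n) → tri x y z ≡ tri x z y
tri-swap₂₃ x y z = cong (⁅ x ⁆ ∪_) (∪-comm ⁅ y ⁆ ⁅ z ⁆)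

module _ {n : ℕ} {χ : Subset n → Bool} {p11 p12 p21 p22 : ℕ} (equitable : IsEquitable2 n χ p11 p12 p21 p22) where
  open IsEquitable2 equitable

  pairCountSum-X₁ : ∀ {x y z} → Distinct3 x y z → χ (tri x y z) ≡ true →
    p11 + 3 ≡ pairCount χ x y + pairCount χ x z + pairCount χ y z
  pairCountSum-X₁ d v∈X₁ =
    trans (cong₂ (λ k b → k + 3 * ind b) (sym (proj₁ (row1 _ (∣tri∣≡3 d) v∈X₁))) (sym v∈X₁)) (nbrsIn-tri χ d)

  pairCountSum-X₂ : ∀ {x y z} → Distinct3 x y z → χ (tri x y z) ≡ false →
    p21 ≡ pairCount χ x y + pairCount χ x z + pairCount χ y z
  pairCountSum-X₂ d v∈X₂ = trans (sym (+-identityʳ p21))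
    (trans (cong₂ (λ k b → k + 3 * ind b) (sym (proj₁ (row2 _ (∣tri∣≡3 d) v∈X₂))) (sym v∈X₂)) (nbrsIn-tri χ d))

m+m≡n+n⇒m≡n : ∀ {m n} → m + m ≡ n + n → m ≡ n
m+m≡n+n⇒m≡n {m} {n} eq = *-cancelˡ-≡ m n 2 (trans (double m) (trans eq (sym (double n))))
  where
  double : ∀ k → 2 * k ≡ k + k
  double k = cong (k +_) (+-identityʳ k)

module Configuration
  {n : ℕ} {χ : Subset n → Bool} {p11 p12 p21 p22 : ℕ}
  (equitable : IsEquitable2 n χ p11 p12 p21 p22) (λ₂ : IsLambda2 n p11 p21) (p11-large : 2 * n ≤ p11 + 7)
  {a b c : Fin n} (distinct : Distinct3 a b c) (abc∈X₁ : χ (tri a b c) ≡ true)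
  (ab-gap : 2 * pairCount χ a b + 4 ≡ 2 * pairCount χ a c + n)
  (ac≡bc : pairCount χ a c ≡ pairCount χ b c)
  (profile : ∀ (d : Fin n) → d ≢ a → d ≢ b → d ≢ c →
    (χ (tri a b d) ≡ true × χ (tri a c d) ≡ true × χ (tri b c d) ≡ true)
    ⊎ (χ (tri a b d) ≡ true × χ (tri a c d) ≡ false × χ (tri b c d) ≡ false))
  where

  private
    a≢b : a ≢ b
    a≢b = proj₁ distinct
    a≢c : a ≢ c
    a≢c = proj₁ (proj₂ distinct)
    b≢c : b ≢ c
    b≢c = proj₂ (proj₂ distinct)

  A C : ℕ
  A = pairCount χ a b
  C = pairCount χ a c

  abc-sum : p11 + 3 ≡ A + C + C
  abc-sum = trans (pairCountSum-X₁ equitable distinct abc∈X₁) (cong (A + C +_) (sym ac≡bc))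

  n≤A+2 : n ≤ A + 2
  n≤A+2 = m<1+n⇒m≤n (*-cancelˡ-< 3 n (suc (A + 2)) (begin-strict
    3 * n                ≡⟨ split-3 n ⟩
    2 * n + n            ≤⟨ +-monoˡ-≤ n p11-large ⟩
    p11 + 7 + n          ≡⟨ cong (_+ n) (+-assoc p11 3 4) ⟨
    p11 + 3 + 4 + n      ≡⟨ cong (λ t → t + 4 + n) abc-sum ⟩
    A + C + C + 4 + n    ≡⟨ regroup A C n ⟩
    A + 4 + (2 * C + n)  ≡⟨ cong (A + 4 +_) ab-gap ⟨
    A + 4 + (2 * A + 4)  <⟨ ≤-reflexive (just-below A) ⟩
    3 * suc (A + 2)      ∎))
    where
    open ≤-Reasoning
    split-3 : ∀ n → 3 * n ≡ 2 * n + n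
    split-3 = solve-∀
    regroup : ∀ A C n → A + C + C + 4 + n ≡ A + 4 + (2 * C + n)
    regroup = solve-∀
    just-below : ∀ A → suc (A + 4 + (2 * A + 4)) ≡ 3 * suc (A + 2)
    just-below = solve-∀

  abd∈X₁ : ∀ {d} → d ≢ a → d ≢ b → d ≢ c → χ (tri a b d) ≡ true
  abd∈X₁ {d} d≢a d≢b d≢c with profile d d≢a d≢b d≢c
  ... | inj₁ (abd , _ , _) = abd
  ... | inj₂ (abd , _ , _) = abd

  bcd≡acd : ∀ {d} → d ≢ a → d ≢ b → d ≢ c → χ (tri b c d) ≡ χ (tri a c d)
  bcd≡acd {d} d≢a d≢b d≢c with profile d d≢a d≢b d≢c
  ... | inj₁ (_ , acd , bcd) = trans bcd (sym acd)
  ... | inj₂ (_ , acd , bcd) = trans bcd (sym acd)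

  -- Q is p₁₁ + 3 or p₂₁, according to the common part of {a,c,d} and {b,c,d}.
  ad≡C : ∀ {d Q} → d ≢ a → d ≢ b → d ≢ c →
    Q ≡ C + pairCount χ a d + pairCount χ c d → Q ≡ C + pairCount χ b d + pairCount χ c d →
    pairCount χ a d ≡ C
  ad≡C {d} d≢a d≢b d≢c acd-sum bcd-sum = m+m≡n+n⇒m≡n (+-cancelˡ-≡ A _ _ (begin
    A + (ad + ad)  ≡⟨ +-assoc A ad ad ⟨
    A + ad + ad    ≡⟨ cong (A + ad +_) ad≡bd ⟩
    A + ad + bd    ≡⟨ pairCountSum-X₁ equitable (a≢b , ≢-sym d≢a , ≢-sym d≢b) (abd∈X₁ d≢a d≢b d≢c) ⟨
    p11 + 3        ≡⟨ abc-sum ⟩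
    A + C + C      ≡⟨ +-assoc A C C ⟩
    A + (C + C)    ∎))
    where
    open ≡-Reasoning
    ad = pairCount χ a d
    bd = pairCount χ b d
    ad≡bd : ad ≡ bd
    ad≡bd = +-cancelˡ-≡ C _ _ (+-cancelʳ-≡ (pairCount χ c d) _ _ (trans (sym acd-sum) bcd-sum))

  cd≡A : ∀ {d} → d ≢ a → d ≢ b → d ≢ c → χ (tri a c d) ≡ true → pairCount χ c d ≡ A
  cd≡A {d} d≢a d≢b d≢c acd∈X₁ = +-cancelˡ-≡ (C + C) _ _ (begin
    C + C + cd  ≡⟨ cong (λ t → C + t + cd) (ad≡C d≢a d≢b d≢c acd-sum bcd-sum) ⟨
    C + ad + cd ≡⟨ acd-sum ⟨
    p11 + 3     ≡⟨ abc-sum ⟩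
    A + C + C   ≡⟨ trans (+-assoc A C C) (+-comm A (C + C)) ⟩
    C + C + A   ∎)
    where
    open ≡-Reasoning
    ad = pairCount χ a d
    cd = pairCount χ c d
    acd-sum : p11 + 3 ≡ C + ad + cd
    acd-sum = pairCountSum-X₁ equitable (a≢c , ≢-sym d≢a , ≢-sym d≢c) acd∈X₁
    bcd-sum : p11 + 3 ≡ C + pairCount χ b d + cd
    bcd-sum = trans (pairCountSum-X₁ equitable (b≢c , ≢-sym d≢b , ≢-sym d≢c)
                      (trans (bcd≡acd d≢a d≢b d≢c) acd∈X₁))
                    (cong (λ t → t + _ + cd) (sym ac≡bc))

  ce+n≡A+4 : ∀ {e} → e ≢ a → e ≢ b → e ≢ c → χ (tri a c e) ≡ false → pairCount χ c e + n ≡ A + 4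
  ce+n≡A+4 {e} e≢a e≢b e≢c ace∈X₂ = +-cancelˡ-≡ (C + C) _ _ (begin
    C + C + (ce + n)  ≡⟨ +-assoc (C + C) ce n ⟨
    C + C + ce + n    ≡⟨ cong (λ t → C + t + ce + n) (ad≡C e≢a e≢b e≢c ace-sum bce-sum) ⟨
    C + ae + ce + n   ≡⟨ cong (_+ n) ace-sum ⟨
    p21 + n           ≡⟨ λ₂ ⟨
    p11 + 7           ≡⟨ +-assoc p11 3 4 ⟨
    p11 + 3 + 4       ≡⟨ cong (_+ 4) abc-sum ⟩
    A + C + C + 4     ≡⟨ regroup A C ⟩
    C + C + (A + 4)   ∎)
    where
    open ≡-Reasoning
    ae = pairCount χ a e
    ce = pairCount χ c e
    ace-sum : p21 ≡ C + ae + ce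
    ace-sum = pairCountSum-X₂ equitable (a≢c , ≢-sym e≢a , ≢-sym e≢c) ace∈X₂
    bce-sum : p21 ≡ C + pairCount χ b e + ce
    bce-sum = trans (pairCountSum-X₂ equitable (b≢c , ≢-sym e≢b , ≢-sym e≢c)
                      (trans (bcd≡acd e≢a e≢b e≢c) ace∈X₂))
                    (cong (λ t → t + _ + ce) (sym ac≡bc))
    regroup : ∀ A C → A + C + C + 4 ≡ C + C + (A + 4)
    regroup = solve-∀

  -- cd* = ab* = n − 2 is maximal.
  cd-full : ∀ {d} → d ≢ a → d ≢ b → d ≢ c → χ (tri a c d) ≡ true →
    ∀ z → z ≢ c → z ≢ d → χ (tri c d z) ≡ true
  cd-full d≢a d≢b d≢c acd∈X₁ =
    pairCount-full⁻ χ (≢-sym d≢c) (subst (λ k → n ≤ k + 2) (sym (cd≡A d≢a d≢b d≢c acd∈X₁)) n≤A+2)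

  C≤1+ce : ∀ {e} → e ≢ a → e ≢ b → e ≢ c → χ (tri a c e) ≡ false → C ≤ 1 + pairCount χ c e
  C≤1+ce {e} e≢a e≢b e≢c ace∈X₂ = pairCount≤1+pairCount χ b a≢c (≢-sym e≢c) through-ce
    where
    through-ce : ∀ z → z ≢ a → z ≢ c → z ≢ b → χ (tri a c z) ≡ true →
      z ≢ c × z ≢ e × χ (tri c e z) ≡ true
    through-ce z z≢a z≢c z≢b acz∈X₁ =
      z≢c , z≢e , trans (cong χ (tri-swap₂₃ c e z)) (cd-full z≢a z≢b z≢c acz∈X₁ e e≢c (≢-sym z≢e))
      where
      z≢e : z ≢ e
      z≢e refl with trans (sym acz∈X₁) ace∈X₂
      ... | ()

  n≤6-from-X₂-vertex : ∀ {e} → e ≢ a → e ≢ b → e ≢ c → χ (tri a c e) ≡ false → n ≤ 6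
  n≤6-from-X₂-vertex {e} e≢a e≢b e≢c ace∈X₂ = +-cancelˡ-≤ (2 * A + 4) n 6 (begin
    2 * A + 4 + n         ≡⟨ cong (_+ n) ab-gap ⟩
    2 * C + n + n         ≤⟨ +-monoˡ-≤ n (+-monoˡ-≤ n (*-monoʳ-≤ 2 (C≤1+ce e≢a e≢b e≢c ace∈X₂))) ⟩
    2 * (1 + ce) + n + n  ≡⟨ regroup ce n ⟩
    2 + 2 * (ce + n)      ≡⟨ cong (λ t → 2 + 2 * t) (ce+n≡A+4 e≢a e≢b e≢c ace∈X₂) ⟩
    2 + 2 * (A + 4)       ≡⟨ regroup′ A ⟩
    2 * A + 4 + 6         ∎)
    where
    open ≤-Reasoning
    ce = pairCount χ c e
    regroup : ∀ ce n → 2 * (1 + ce) + n + n ≡ 2 + 2 * (ce + n)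
    regroup = solve-∀
    regroup′ : ∀ A → 2 + 2 * (A + 4) ≡ 2 * A + 4 + 6
    regroup′ = solve-∀

  n≤6-from-ac-full : C + 2 ≡ n → n ≤ 6
  n≤6-from-ac-full C+2≡n = ≤-trans (+-cancelˡ-≤ (2 * n) n 4 (begin
    2 * n + n        ≡⟨ cong (λ t → 2 * t + n) C+2≡n ⟨
    2 * (C + 2) + n  ≡⟨ regroup C n ⟩
    2 * C + n + 4    ≡⟨ cong (_+ 4) ab-gap ⟨
    2 * A + 4 + 4    ≡⟨ regroup′ A ⟩
    2 * (A + 2) + 4  ≤⟨ +-monoˡ-≤ 4 (*-monoʳ-≤ 2 (pairCount+2≤n χ a≢b)) ⟩
    2 * n + 4        ∎)) (m≤m+n 4 2)
    where
    open ≤-Reasoning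
    regroup : ∀ C n → 2 * (C + 2) + n ≡ 2 * C + n + 4
    regroup = solve-∀
    regroup′ : ∀ A → 2 * A + 4 + 4 ≡ 2 * (A + 2) + 4
    regroup′ = solve-∀

  n≤6 : n ≤ 6
  n≤6 with any? (λ e → ¬? (e ≟ a) ×-dec ¬? (e ≟ b) ×-dec ¬? (e ≟ c) ×-dec (χ (tri a c e) ≟ᵇ false))
  ... | yes (e , e≢a , e≢b , e≢c , ace∈X₂) = n≤6-from-X₂-vertex e≢a e≢b e≢c ace∈X₂
  ... | no no-X₂-vertex = n≤6-from-ac-full (pairCount-full⁺ χ a≢c ac-full)
    where
    ac-full : ∀ z → z ≢ a → z ≢ c → χ (tri a c z) ≡ true
    ac-full z z≢a z≢c with z ≟ b
    ... | yes refl = trans (cong χ (tri-swap₂₃ a c b)) abc∈X₁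
    ... | no z≢b with χ (tri a c z) in acz
    ...   | true  = refl
    ...   | false = contradiction (z , z≢a , z≢b , z≢c , acz) no-X₂-vertex

mainTheorem17 : (n : ℕ) → 6 ≤ n →
    (χ : Subset n → Bool) → (p11 p12 p21 p22 : ℕ) →
    IsEquitable2 n χ p11 p12 p21 p22 →
    IsLambda2 n p11 p21 →
    p22 ≤ p11 →
    2 * n ≤ p11 + 7 →
    (∀ v → ¬ TypeI n χ v) →
    (∀ v → ¬ TypeII n χ v) →
    (a b c : Fin n) → Distinct3 a b c →
    χ (tri a b c) ≡ true →
    2 * pairCount χ a b + 4 ≡ 2 * pairCount χ a c + n →
    pairCount χ a c ≡ pairCount χ b c →
    (∀ (d : Fin n) → d ≢ a → d ≢ b → d ≢ c →
      (χ (tri a b d) ≡ true × χ (tri a c d) ≡ true × χ (tri b c d) ≡ true)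
      ⊎ (χ (tri a b d) ≡ true × χ (tri a c d) ≡ false × χ (tri b c d) ≡ false)) →
    n ≤ 6
mainTheorem17 n _ χ p11 p12 p21 p22 equitable λ₂ _ p11-large _ _ a b c distinct abc∈X₁ ab-gap ac≡bc profile =
  Configuration.n≤6 equitable λ₂ p11-large distinct abc∈X₁ ab-gap ac≡bc profile
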